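{- Let $\mu$ and $\nu$ be partitions of lengths $m$ and $r$ respectively. If there is a non-zero partition reordering $\pm B_\lambda$ of $B_{\mu,\nu}$ (i.e. $B_{\mu,\nu}=\pm B_\lambda\neq 0$ with $\lambda$ a partition obtained from $(\mu,\nu)$ by repeated use of the reordering relation), then $\lambda_1=\max\{\mu_1,\nu_1-m\}$ and $\lambda_{m+r}=\min\{\mu_m+r,\nu_r\}$.
   Context: For $\ell\in\mathbb Z$, $B_\ell=\sum_{i\ge0}s_{i+\ell}[X]\,s_i[X(t-1)]^\perp$ acting on symmetric functions over $\mathbb Q(q,t)$ (here $f^\perp$ is adjoint to multiplication by $f$ for the Hall scalar product, and $s_i[X(t-1)]$ is the plethystic substitution $p_n\mapsto(t^n-1)p_n$), and for $v\in\mathbb Z^L$, $B_v=\prod_{i<j}(1-te_{ij})B_{v_1}\cdots B_{v_L}$ with $e_{ij}$ raising the $i$-th index by one and lowering the $j$-th by one. These operators satisfy the reordering relation $B_v=-B_{v_1,\dots,v_{i-1},v_{i+1}-1,v_i+1,v_{i+2},\dots,v_L}$; a partition reordering of $B_v$ is an expression $\pm B_\lambda$, $\lambda$ a partition, obtained from $B_v$ by repeated application of this relation. $(\mu,\nu)$ denotes concatenation. -}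

module Defs where

open import Data.Nat as ℕ using (ℕ; zero; suc; _≡ᵇ_; _≤ᵇ_; _⊔_)
open import Data.Integer as ℤ using (ℤ; +_; -[1+_])
open import Data.Rational as ℚ using (ℚ; 0ℚ; 1ℚ)
open import Data.List using (List; []; _∷_; _++_; map; concatMap; foldr; length)
open import Data.Nat.ListAction using (sum)
open import Data.List.Properties using (≡-dec)
open import Data.Bool using (Bool; true; false; if_then_else_; _∧_)
open import Data.Product using (_×_; _,_; ∃-syntax)
open import Data.List.Relation.Unary.All using (All)
open import Data.List.Relation.Unary.Linked using (Linked)
open import Relation.Nullary using (does)
open import Relation.Binary.PropositionalEquality using (_≡_; _≢_)
open import Relation.Binary.Construct.Closure.ReflexiveTransitive using (Star)

-- Symmetric functions with coefficients in ℚ[t], in the power-sum basis.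
--
-- The power sums p_1, p_2, ... are algebraically independent, so
-- Λ_{ℚ[t]} = ℚ[t][p_1, p_2, ...].  An element is represented as a finite
-- formal sum of terms  c · t^e · p_{k₁+1} ⋯ p_{kₙ+1},  where the monomial
-- is stored as the ascending list [k₁, …, kₙ] (entry k stands for p_{k+1}).
-- All operations below keep monomials sorted, and equality of elements is
-- tested through coefficient extraction (coeffOf), so no normal form is
-- needed.  (The operators B_ℓ only involve t, so working over ℚ[t] ⊂ ℚ(q,t)
-- loses nothing.)

Mono : Set
Mono = List ℕ

record Term : Set where
  constructor term
  field
    texp : ℕ
    mono : Mono
    coef : ℚ

Λ : Set
Λ = List Term

insert : ℕ → Mono → Mono
insert k []       = k ∷ []
insert k (x ∷ xs) = if k ≤ᵇ x then k ∷ x ∷ xs else x ∷ insert k xs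

sortMono : Mono → Mono
sortMono = foldr insert []

mmul : Mono → Mono → Mono
mmul a b = foldr insert b a

count : ℕ → Mono → ℕ
count k []       = 0
count k (x ∷ xs) = if k ≡ᵇ x then suc (count k xs) else count k xs

removeOne : ℕ → Mono → Mono
removeOne k []       = []
removeOne k (x ∷ xs) = if k ≡ᵇ x then xs else x ∷ removeOne k xs

tmul : Term → Term → Term
tmul (term e₁ m₁ c₁) (term e₂ m₂ c₂) = term (e₁ ℕ.+ e₂) (mmul m₁ m₂) (c₁ ℚ.* c₂)

_⊕_ : Λ → Λ → Λ
_⊕_ = _++_

_⊗_ : Λ → Λ → Λ
f ⊗ g = concatMap (λ x → map (tmul x) g) f

scal : Term → Λ → Λ
scal x f = map (tmul x) f

ℚ↑ : ℕ → ℚ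
ℚ↑ n = ℚ._/_ (+ n) 1

deriv : ℕ → Λ → Λ
deriv k = concatMap dT
  where
  dT : Term → Λ
  dT (term e m c) with count k m
  ... | zero  = []
  ... | suc n = term e (removeOne k m) (c ℚ.* ℚ↑ (suc n)) ∷ []

-- p_{k+1}^⊥ = (k+1) ∂/∂p_{k+1}   (adjoint for the Hall scalar product)
pPerp : ℕ → Λ → Λ
pPerp k f = scal (term 0 [] (ℚ↑ (suc k))) (deriv k f)

-- g^⊥ for arbitrary g:  (c t^e p_ρ)^⊥ = c t^e ∏_j p_{ρ_j}^⊥, extended linearly
perp : Λ → Λ → Λ
perp g f = concatMap (λ x → tPerp x) g
  where
  tPerp : Term → Λ
  tPerp (term e m c) = scal (term e [] c) (foldr pPerp f m)

-- One-row Schur functions s_k = h_k via Newton's identity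
--   k h_k = Σ_{i=1}^k p_i h_{k-i},
-- parametrised by the image P j of p_{j+1}; since plethystic substitution
-- f ↦ f[A] is the ring map p_n ↦ p_n[A], this also computes s_k[A].

one : Λ
one = term 0 [] 1ℚ ∷ []

-- hRev P n = [h_n, h_{n-1}, …, h_0]
hRev : (ℕ → Λ) → ℕ → List Λ
hRev P zero    = one ∷ []
hRev P (suc n) = new ∷ prev
  where
  prev : List Λ
  prev = hRev P n
  go : ℕ → List Λ → Λ
  go j []       = []
  go j (h ∷ hs) = (P j ⊗ h) ⊕ go (suc j) hs
  new : Λ
  new = scal (term 0 [] (ℚ._/_ (+ 1) (suc n))) (go 0 prev)

hd : List Λ → Λ
hd []      = []
hd (x ∷ _) = x

hGen : (ℕ → Λ) → ℕ → Λ
hGen P n = hd (hRev P n)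

pvar : ℕ → Λ
pvar j = term 0 (j ∷ []) 1ℚ ∷ []

-- p_{j+1}[X(t-1)] = (t^{j+1} - 1) p_{j+1}
pvarT : ℕ → Λ
pvarT j = term (suc j) (j ∷ []) 1ℚ ∷ term 0 (j ∷ []) (ℚ.- 1ℚ) ∷ []

s : ℤ → Λ
s (+ n)    = hGen pvar n
s -[1+ n ] = []

sT : ℕ → Λ
sT i = hGen pvarT i

degree : Λ → ℕ
degree f = foldr (λ x d → wt (Term.mono x) ⊔ d) 0 f
  where
  wt : Mono → ℕ
  wt m = sum (map suc m)

-- B_ℓ f = Σ_{i ≥ 0} s_{i+ℓ} · s_i[X(t-1)]^⊥ f ; terms with i > deg f vanish
B1 : ℤ → Λ → Λ
B1 ℓ f = go (degree f)
  where
  term-i : ℕ → Λ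
  term-i i = s (+ i ℤ.+ ℓ) ⊗ perp (sT i) f
  go : ℕ → Λ
  go zero    = term-i 0
  go (suc n) = term-i (suc n) ⊕ go n

Bprod : List ℤ → Λ → Λ
Bprod []       f = f
Bprod (ℓ ∷ ls) f = B1 ℓ (Bprod ls f)

-- raising operator e_ij on index vectors (0-based positions)
adjust : ℕ → (ℤ → ℤ) → List ℤ → List ℤ
adjust _       g []       = []
adjust zero    g (x ∷ xs) = g x ∷ xs
adjust (suc i) g (x ∷ xs) = x ∷ adjust i g xs

raise : ℕ × ℕ → List ℤ → List ℤ
raise (i , j) v = adjust j (λ x → x ℤ.- ℤ.1ℤ) (adjust i (λ x → x ℤ.+ ℤ.1ℤ) v)

pairsBelow : ℕ → List (ℕ × ℕ)
pairsBelow zero    = []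
pairsBelow (suc j) = pairsBelow j ++ map (λ i → (i , j)) (range j)
  where
  range : ℕ → List ℕ
  range zero    = []
  range (suc n) = range n ++ (n ∷ [])

-- expansion of ∏_{i<j} (1 - t e_ij) applied to v: list of (k , w) meaning
-- the summand (-t)^k B_w
expand : List (ℕ × ℕ) → List ℤ → List (ℕ × List ℤ)
expand []       v = (0 , v) ∷ []
expand (p ∷ ps) v = concatMap (λ { (k , w) → (k , w) ∷ (suc k , raise p w) ∷ [] }) (expand ps v)

signPow : ℕ → ℚ
signPow zero    = 1ℚ
signPow (suc k) = ℚ.- signPow k

B : List ℤ → Λ → Λ
B v f = concatMap (λ { (k , w) → scal (term k [] (signPow k)) (Bprod w f) })
                  (expand (pairsBelow (length v)) v)

coeffOf : ℕ → Mono → Λ → ℚ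
coeffOf e m []                  = 0ℚ
coeffOf e m (term e' m' c ∷ f) =
  if (e ≡ᵇ e') ∧ does (≡-dec ℕ._≟_ m m') then c ℚ.+ coeffOf e m f else coeffOf e m f

NonzeroΛ : Λ → Set
NonzeroΛ f = ∃[ e ] ∃[ m ] coeffOf e m f ≢ 0ℚ

normalize : Λ → Λ
normalize = map (λ { (term e m c) → term e (sortMono m) c })

NonzeroOp : (Λ → Λ) → Set
NonzeroOp Op = ∃[ f ] NonzeroΛ (Op (normalize f))

-- one application of B_v = - B_{…, v_{i+1}-1, v_i+1, …}
data ReorderStep : List ℤ → List ℤ → Set where
  here  : ∀ {a b xs} → ReorderStep (a ∷ b ∷ xs) ((b ℤ.- ℤ.1ℤ) ∷ (a ℤ.+ ℤ.1ℤ) ∷ xs)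
  there : ∀ {x xs ys} → ReorderStep xs ys → ReorderStep (x ∷ xs) (x ∷ ys)

Reorders : List ℤ → List ℤ → Set
Reorders = Star ReorderStep

IsPartition : List ℤ → Set
IsPartition v = All (ℤ._≤_ (+ 0)) v × Linked ℤ._≥_ v

IsPartitionOfLength : ℕ → List ℤ → Set
IsPartitionOfLength m v = length v ≡ m × All (ℤ._<_ (+ 0)) v × Linked ℤ._≥_ v

-- 1-based entry v_i (default 0 out of range)
at : List ℤ → ℕ → ℤ
at []       _             = + 0
at (x ∷ _)  (suc zero)    = x
at (_ ∷ xs) (suc (suc i)) = at xs (suc i)
at (_ ∷ _)  zero          = + 0

-- Write (v₁, …, v_L) ↦ (v₁ - 0, v₂ - 1, …, v_L - (L - 1)).  The reordering
-- relation swaps two adjacent entries of this shifted sequence, so it only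
-- permutes it.  For a partition λ the shifted sequence is weakly decreasing,
-- hence λ₁ is its maximum and λ_L - (L - 1) its minimum.  Computing maximum
-- and minimum instead on the shifted sequence of (μ, ν), which is the shifted
-- sequence of μ followed by that of ν shifted by m more, gives λ₁ and λ_{m+r}.
module Submission where

open import Defs
open import Data.Nat using (ℕ; _≤_; _+_)
open import Data.Integer using (ℤ; +_; _-_; _⊔_; _⊓_)
open import Data.List using (List; _++_)
open import Data.Product using (_×_)
open import Relation.Binary.PropositionalEquality using (_≡_)

open import Algebra.Bundles using (AbelianGroup)
open import Data.Nat as ℕ using (suc; _<_; s≤s)
import Data.Nat.Properties as ℕ
open import Data.Integer as ℤ using (0ℤ; 1ℤ)
open import Data.Integer.Properties as ℤ
  using (≤-refl; ≤-trans; ≤-antisym; +-identityʳ; +-assoc; +-mono-≤; +-monoˡ-≤; neg-mono-≤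
        ; i≤i+j; i≤i⊔j; i≤j⊔i; i⊓j≤i; i⊓j≤j; ⊔-sel; ⊓-sel; mono-≤-distrib-⊓)
open import Data.Integer.Tactic.RingSolver using (solve-∀)
open import Data.List using ([]; _∷_; length)
open import Data.List.Properties using (length-++)
open import Data.List.Membership.Propositional using (_∈_)
open import Data.List.Membership.Propositional.Properties using (∈-++⁺ˡ; ∈-++⁺ʳ)
open import Data.List.Relation.Binary.Permutation.Propositional as ↭ using (_↭_)
open import Data.List.Relation.Binary.Permutation.Propositional.Properties
  using (∈-resp-↭; All-resp-↭; ↭-length)
open import Data.List.Relation.Unary.All as All using (All; []; _∷_)
open import Data.List.Relation.Unary.All.Properties using (++⁺)
open import Data.List.Relation.Unary.Any using (here; there)
open import Data.List.Relation.Unary.Linked using (Linked; []; [-]; _∷_)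
open import Data.List.Relation.Unary.Linked.Properties using (Linked⇒All)
open import Data.Product using (_,_)
open import Data.Sum using (inj₁; inj₂)
open import Function using (flip)
open import Relation.Binary.Construct.Closure.ReflexiveTransitive using (ε; _◅_)
open import Relation.Binary.PropositionalEquality
  using (refl; sym; trans; cong; cong₂; subst; module ≡-Reasoning)

open import Algebra.Properties.Group (AbelianGroup.group ℤ.+-0-abelianGroup)
  using (∙-cancelʳ)

private
  variable
    a b k : ℤ
    n : ℕ
    xs ys v w : List ℤ

IsMax IsMin : ℤ → List ℤ → Set
IsMax a xs = a ∈ xs × All (ℤ._≤ a) xs
IsMin a xs = a ∈ xs × All (a ℤ.≤_) xs

↭-IsMax-unique : xs ↭ ys → IsMax a xs → IsMax b ys → a ≡ b
↭-IsMax-unique p (a∈ , ≤a) (b∈ , ≤b) =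
  ≤-antisym (All.lookup ≤b (∈-resp-↭ p a∈)) (All.lookup (All-resp-↭ p ≤a) b∈)

↭-IsMin-unique : xs ↭ ys → IsMin a xs → IsMin b ys → a ≡ b
↭-IsMin-unique p (a∈ , a≤) (b∈ , b≤) =
  ≤-antisym (All.lookup (All-resp-↭ p a≤) b∈) (All.lookup b≤ (∈-resp-↭ p a∈))

IsMax-++ : IsMax a xs → IsMax b ys → IsMax (a ⊔ b) (xs ++ ys)
IsMax-++ {a} {xs} {b} {ys} (a∈ , ≤a) (b∈ , ≤b) =
  a⊔b∈ , ++⁺ (All.map (flip ≤-trans (i≤i⊔j a b)) ≤a) (All.map (flip ≤-trans (i≤j⊔i a b)) ≤b)
  where
  a⊔b∈ : a ⊔ b ∈ xs ++ ys
  a⊔b∈ with ⊔-sel a b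
  ... | inj₁ a⊔b≡a = subst (_∈ xs ++ ys) (sym a⊔b≡a) (∈-++⁺ˡ a∈)
  ... | inj₂ a⊔b≡b = subst (_∈ xs ++ ys) (sym a⊔b≡b) (∈-++⁺ʳ xs b∈)

IsMin-++ : IsMin a xs → IsMin b ys → IsMin (a ⊓ b) (xs ++ ys)
IsMin-++ {a} {xs} {b} {ys} (a∈ , a≤) (b∈ , b≤) =
  a⊓b∈ , ++⁺ (All.map (≤-trans (i⊓j≤i a b)) a≤) (All.map (≤-trans (i⊓j≤j a b)) b≤)
  where
  a⊓b∈ : a ⊓ b ∈ xs ++ ys
  a⊓b∈ with ⊓-sel a b
  ... | inj₁ a⊓b≡a = subst (_∈ xs ++ ys) (sym a⊓b≡a) (∈-++⁺ˡ a∈)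
  ... | inj₂ a⊓b≡b = subst (_∈ xs ++ ys) (sym a⊓b≡b) (∈-++⁺ʳ xs b∈)

head-IsMax : Linked ℤ._≥_ (a ∷ xs) → IsMax a (a ∷ xs)
head-IsMax a∷xs↓ = here refl , Linked⇒All (flip ≤-trans) ≤-refl a∷xs↓

last-IsMin : length v ≡ suc n → Linked ℤ._≥_ v → IsMin (at v (suc n)) v
last-IsMin {_ ∷ []}    {ℕ.zero} _   _             = here refl , ≤-refl ∷ []
last-IsMin {_ ∷ _ ∷ _} {suc n}  |v| (x≥y ∷ y∷ys↓)
  with last-IsMin {n = n} (ℕ.suc-injective |v|) y∷ys↓
... | ∈y∷ys , ≤y∷ys = there ∈y∷ys , ≤-trans (All.head ≤y∷ys) x≥y ∷ ≤y∷ys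

sub-sub : ∀ a b c → a - b - c ≡ a - (c ℤ.+ b)
sub-sub = solve-∀

sub-+-cancelʳ : ∀ a b c → a ℤ.+ c - (b ℤ.+ c) ≡ a - b
sub-+-cancelʳ = solve-∀

shifted : ℤ → List ℤ → List ℤ
shifted k []       = []
shifted k (x ∷ xs) = x - k ∷ shifted (k ℤ.+ 1ℤ) xs

length-shifted : ∀ k v → length (shifted k v) ≡ length v
length-shifted k []       = refl
length-shifted k (x ∷ xs) = cong suc (length-shifted (k ℤ.+ 1ℤ) xs)

shifted-++ : ∀ k xs ys → shifted k (xs ++ ys) ≡ shifted k xs ++ shifted (k ℤ.+ + length xs) ys
shifted-++ k []       ys = cong (λ j → shifted j ys) (sym (+-identityʳ k))
shifted-++ k (x ∷ xs) ys = cong (x - k ∷_) (trans (shifted-++ (k ℤ.+ 1ℤ) xs ys)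
  (cong (λ j → shifted (k ℤ.+ 1ℤ) xs ++ shifted j ys) (+-assoc k 1ℤ (+ length xs))))

at-shifted : ∀ k v → n < length v → at (shifted k v) (suc n) ≡ at v (suc n) - (k ℤ.+ + n)
at-shifted {ℕ.zero} k (x ∷ xs) _        = cong (x -_) (sym (+-identityʳ k))
at-shifted {suc n}  k (x ∷ xs) (s≤s n<) = trans (at-shifted (k ℤ.+ 1ℤ) xs n<)
  (cong (at xs (suc n) -_) (+-assoc k 1ℤ (+ n)))

sub-mono-≤-shift : ∀ k → b ℤ.≤ a → b - (k ℤ.+ 1ℤ) ℤ.≤ a - k
sub-mono-≤-shift k b≤a = +-mono-≤ b≤a (neg-mono-≤ (i≤i+j k 1ℤ))

shifted-antitone : Linked ℤ._≥_ v → Linked ℤ._≥_ (shifted k v)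
shifted-antitone                   []            = []
shifted-antitone                   [-]           = [-]
shifted-antitone {_ ∷ _ ∷ _} {k} (x≥y ∷ y∷ys↓) = sub-mono-≤-shift k x≥y ∷ shifted-antitone y∷ys↓

shifted-IsMax : Linked ℤ._≥_ v → length v ≡ suc n → IsMax (at v 1 - k) (shifted k v)
shifted-IsMax {_ ∷ _} v↓ _ = head-IsMax (shifted-antitone v↓)

shifted-IsMin : Linked ℤ._≥_ v → length v ≡ suc n →
                IsMin (at v (suc n) - (k ℤ.+ + n)) (shifted k v)
shifted-IsMin {v} {n} {k} v↓ |v| =
  subst (λ c → IsMin c (shifted k v)) (at-shifted k v (ℕ.≤-reflexive (sym |v|)))
        (last-IsMin (trans (length-shifted k v) |v|) (shifted-antitone v↓))

ReorderStep⇒shifted-↭ : ReorderStep v w → ∀ k → shifted k v ↭ shifted k w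
ReorderStep⇒shifted-↭ (here {a} {b}) k
  rewrite sub-sub b 1ℤ k | sub-+-cancelʳ a k 1ℤ = ↭.swap _ _ ↭.refl
ReorderStep⇒shifted-↭ (there {x} step) k =
  ↭.prep (x - k) (ReorderStep⇒shifted-↭ step (k ℤ.+ 1ℤ))

Reorders⇒shifted-↭ : Reorders v w → ∀ k → shifted k v ↭ shifted k w
Reorders⇒shifted-↭ ε            k = ↭.refl
Reorders⇒shifted-↭ (step ◅ steps) k =
  ↭.trans (ReorderStep⇒shifted-↭ step k) (Reorders⇒shifted-↭ steps k)

Reorders⇒length≡ : Reorders v w → length v ≡ length w
Reorders⇒length≡ {v} {w} v⇝w =
  trans (sym (length-shifted 0ℤ v))
        (trans (↭-length (Reorders⇒shifted-↭ v⇝w 0ℤ)) (length-shifted 0ℤ w))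

module _ {m′ r′ : ℕ} {μ ν λ′ : List ℤ}
         (|μ| : length μ ≡ suc m′) (|ν| : length ν ≡ suc r′)
         (μ↓ : Linked ℤ._≥_ μ) (ν↓ : Linked ℤ._≥_ ν) (λ′↓ : Linked ℤ._≥_ λ′)
         (μν⇝λ′ : Reorders (μ ++ ν) λ′) where

  private
    |λ′| : length λ′ ≡ suc (m′ + suc r′)
    |λ′| = trans (sym (Reorders⇒length≡ μν⇝λ′)) (trans (length-++ μ) (cong₂ _+_ |μ| |ν|))

    shifted-μν↭λ′ : shifted 0ℤ μ ++ shifted (+ suc m′) ν ↭ shifted 0ℤ λ′
    shifted-μν↭λ′ = subst (_↭ shifted 0ℤ λ′)
      (trans (shifted-++ 0ℤ μ ν) (cong (λ l → shifted 0ℤ μ ++ shifted (+ l) ν) |μ|))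
      (Reorders⇒shifted-↭ μν⇝λ′ 0ℤ)

  open ≡-Reasoning

  Reorders-first : at λ′ 1 ≡ at μ 1 ⊔ (at ν 1 - + suc m′)
  Reorders-first = begin
    at λ′ 1
      ≡⟨ +-identityʳ (at λ′ 1) ⟨
    at λ′ 1 - 0ℤ
      ≡⟨ ↭-IsMax-unique shifted-μν↭λ′ (IsMax-++ (shifted-IsMax μ↓ |μ|) (shifted-IsMax ν↓ |ν|))
                                      (shifted-IsMax λ′↓ |λ′|) ⟨
    (at μ 1 - 0ℤ) ⊔ (at ν 1 - + suc m′)
      ≡⟨ cong (_⊔ _) (+-identityʳ (at μ 1)) ⟩
    at μ 1 ⊔ (at ν 1 - + suc m′)
      ∎

  Reorders-last : at λ′ (suc m′ + suc r′) ≡ (at μ (suc m′) ℤ.+ + suc r′) ⊓ at ν (suc r′)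
  Reorders-last = ∙-cancelʳ (ℤ.- + ℓ) _ _ (begin
    at λ′ (suc ℓ) - + ℓ
      ≡⟨ ↭-IsMin-unique shifted-μν↭λ′ (IsMin-++ (shifted-IsMin μ↓ |μ|) (shifted-IsMin ν↓ |ν|))
                                      (shifted-IsMin λ′↓ |λ′|) ⟨
    (A - + m′) ⊓ (Bν - + suc (m′ + r′))
      ≡⟨ cong₂ _⊓_ (sub-+-cancelʳ A (+ m′) (+ suc r′)) (cong (λ j → Bν - + j) (ℕ.+-suc m′ r′)) ⟨
    (A ℤ.+ + suc r′ - + ℓ) ⊓ (Bν - + ℓ)
      ≡⟨ mono-≤-distrib-⊓ (+-monoˡ-≤ (ℤ.- + ℓ)) (A ℤ.+ + suc r′) Bν ⟨
    (A ℤ.+ + suc r′) ⊓ Bν - + ℓ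
      ∎)
    where
    ℓ : ℕ
    ℓ = m′ + suc r′
    A Bν : ℤ
    A = at μ (suc m′)
    Bν = at ν (suc r′)

mainTheorem4 : (m r : ℕ) (μ ν λ′ : List ℤ) →
    1 ≤ m → 1 ≤ r →
    IsPartitionOfLength m μ → IsPartitionOfLength r ν →
    Reorders (μ ++ ν) λ′ → IsPartition λ′ → NonzeroOp (B λ′) →
    (at λ′ 1 ≡ at μ 1 ⊔ (at ν 1 - + m)) × (at λ′ (m + r) ≡ (at μ m Data.Integer.+ + r) ⊓ at ν r)
mainTheorem4 (suc m′) (suc r′) μ ν λ′ _ _ (|μ| , _ , μ↓) (|ν| , _ , ν↓) μν⇝λ′ (_ , λ′↓) _ =
  Reorders-first |μ| |ν| μ↓ ν↓ λ′↓ μν⇝λ′ , Reorders-last |μ| |ν| μ↓ ν↓ λ′↓ μν⇝λ′
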